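{- Let $\mathbb{F}$ be a field and $Q\in\mathbb{F}[X_1,\dots,X_d]$ homogeneous of degree $2$. If $D\subseteq\mathbb{F}^d$ is $Q$-generic over $\mathbb{F}$, then for every field extension $\mathbb{K}\geq\mathbb{F}$, the set $D$, viewed as a subset of $\mathbb{K}^d$, is $Q$-generic over $\mathbb{K}$.
   Context: For a field $\mathbb{L}$ and a quadratic form $Q\in\mathbb{L}[X_1,\dots,X_d]$: a $Q$-quadric over $\mathbb{L}$ is a set $\{x\in\mathbb{L}^d:Q(x)+f(x)=0\}$ with $f\in\mathbb{L}[X_1,\dots,X_d]$ of degree at most $1$. A subset $D\subseteq\mathbb{L}^d$ is $Q$-generic over $\mathbb{L}$ if $|D\cap H|\leq d$ for every affine hyperplane $H\subset\mathbb{L}^d$ and $|D\cap S|\leq d+1$ for every $Q$-quadric $S\subset\mathbb{L}^d$ over $\mathbb{L}$. -}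

module Defs where

open import Level using (Level; _⊔_) renaming (suc to lsuc)
open import Data.Nat using (ℕ; _≤_) renaming (zero to zeroℕ; suc to sucℕ)
open import Data.Fin using (Fin; zero; suc) renaming (_≤?_ to _≤ᶠ?_)
import Data.Fin as Fin
open import Data.Bool using (if_then_else_)
open import Data.List using (List; length)
open import Data.List.Relation.Unary.All using (All)
open import Data.List.Relation.Unary.AllPairs using (AllPairs)
open import Data.Product using (Σ; ∃; _×_)
open import Relation.Nullary using (¬_; does)
open import Algebra.Bundles using (CommutativeRing)
open import Algebra.Morphism.Structures using (IsRingHomomorphism)

record Field (c ℓ : Level) : Set (lsuc (c ⊔ ℓ)) where
  field
    commutativeRing : CommutativeRing c ℓ
  open CommutativeRing commutativeRing public
  field
    0≉1     : ¬ (0# ≈ 1#)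
    inverse : ∀ x → ¬ (x ≈ 0#) → ∃ λ y → x * y ≈ 1#

-- A field extension K ≥ F: a (unital) ring homomorphism F → K
-- (automatically injective since F is a field).

record FieldExtension {c ℓ c' ℓ'} (F : Field c ℓ) (K : Field c' ℓ')
       : Set (c ⊔ ℓ ⊔ c' ⊔ ℓ') where
  private
    module F = Field F
    module K = Field K
  field
    embed        : F.Carrier → K.Carrier
    isRingHomo   : IsRingHomomorphism F.rawRing K.rawRing embed

module _ {c ℓ} (L : Field c ℓ) where
  open Field L using (Carrier; _≈_; _+_; _*_; 0#)

  Point : ℕ → Set c
  Point d = Fin d → Carrier

  _≋_ : ∀ {d} → Point d → Point d → Set ℓ
  x ≋ y = ∀ i → x i ≈ y i

  Σ[<_] : ∀ d → (Fin d → Carrier) → Carrier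
  Σ[< zeroℕ ] f = 0#
  Σ[< sucℕ d ] f = f zero + Σ[< d ] (λ i → f (suc i))

  -- A quadratic form Q ∈ L[X_1..X_d] (homogeneous of degree 2), given by
  -- its monomial coefficients q i j (coefficient of X_i X_j) for i ≤ j;
  -- entries q i j with i > j are ignored.
  QuadForm : ℕ → Set c
  QuadForm d = Fin d → Fin d → Carrier

  evalQ : ∀ {d} → QuadForm d → Point d → Carrier
  evalQ {d} q x =
    Σ[< d ] λ i → Σ[< d ] λ j →
      if does (i ≤ᶠ? j) then q i j * (x i * x j) else 0#

  NonzeroQ : ∀ {d} → QuadForm d → Set ℓ
  NonzeroQ {d} q = Σ (Fin d) λ i → Σ (Fin d) λ j → (i Fin.≤ j) × ¬ (q i j ≈ 0#)

  linear : ∀ {d} → (Fin d → Carrier) → Point d → Carrier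
  linear {d} a x = Σ[< d ] λ i → a i * x i

  -- x lies on the affine hyperplane {Σ a_i X_i + b = 0}
  -- (a hyperplane requires a ≠ 0, imposed in IsGeneric)
  OnHyperplane : ∀ {d} → (Fin d → Carrier) → Carrier → Point d → Set ℓ
  OnHyperplane a b x = linear a x + b ≈ 0#

  OnQuadric : ∀ {d} → QuadForm d → (Fin d → Carrier) → Carrier → Point d → Set ℓ
  OnQuadric q a b x = evalQ q x + (linear a x + b) ≈ 0#

  -- |D ∩ S| ≤ n : every list of pairwise distinct points of D ∩ S has
  -- length ≤ n
  AtMost : ∀ {d p s} → ℕ → (Point d → Set p) → (Point d → Set s) → Set (c ⊔ ℓ ⊔ p ⊔ s)
  AtMost {d} n D S =
    (xs : List (Point d)) → AllPairs (λ x y → ¬ (x ≋ y)) xs →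
    All (λ x → D x × S x) xs → length xs ≤ n

  IsGeneric : ∀ {d p} → QuadForm d → (Point d → Set p) → Set (c ⊔ ℓ ⊔ p)
  IsGeneric {d} q D =
    ((a : Fin d → Carrier) (b : Carrier) → (Σ (Fin d) λ i → ¬ (a i ≈ 0#)) →
       AtMost d D (OnHyperplane a b))
    × ((a : Fin d → Carrier) (b : Carrier) →
       AtMost (sucℕ d) D (OnQuadric q a b))

module _ {c ℓ c' ℓ'} {F : Field c ℓ} {K : Field c' ℓ'}
         (E : FieldExtension F K) where
  open FieldExtension E

  mapQ : ∀ {d} → QuadForm F d → QuadForm K d
  mapQ q i j = embed (q i j)

  image : ∀ {d p} → (Point F d → Set p) → Point K d → Set (c ⊔ ℓ' ⊔ p)
  image D y = ∃ λ x → D x × (∀ i → Field._≈_ K (y i) (embed (x i)))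

module Submission where

-- Whether given points x₁,…,xₙ of D lie on a common K-hyperplane or K-quadric Q + f = 0 is the
-- question whether a linear system with coefficients in F has a solution over K: the unknowns
-- are the coefficients of f (for a hyperplane, normalised so that a chosen coefficient is 1).
-- Gaussian elimination never leaves the field of coefficients, so the system is solvable over
-- F as well, and the points lie on an F-hyperplane or F-quadric, where genericity over F
-- bounds n. Constructively, pivot search in a field without decidable equality only yields a
-- doubly negated solution over F; this suffices because the conclusion n ≤ d is decidable.

open import Defs
open import Level using (_⊔_)
open import Data.Nat using (ℕ; _≤_; _≤?_) renaming (zero to zeroℕ; suc to sucℕ)
open import Data.Fin using (Fin; zero; suc)
open import Data.Bool using (Bool; true; false; if_then_else_)
open import Data.Maybe using (nothing)
open import Data.Product using (Σ; ∃; _×_; _,_; proj₁; proj₂)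
open import Function using (_∘_)
open import Data.List using (List; []; _∷_; length; lookup)
open import Data.List.Relation.Unary.All as All using (All; []; _∷_)
open import Data.List.Relation.Unary.AllPairs using (AllPairs; []; _∷_)
open import Data.List.Relation.Unary.Any using (index)
open import Data.List.Relation.Unary.Any.Properties using (lookup-index)
open import Data.List.Membership.Propositional.Properties using (∈-lookup)
open import Relation.Binary.PropositionalEquality as ≡ using (_≡_)
open import Data.Vec.Functional using (tail) renaming (_∷_ to _∷ᶠ_)
open import Relation.Nullary using (¬_; Dec; yes; no)
open import Relation.Nullary.Negation using (¬¬-map)
open import Relation.Nullary.Decidable using (¬¬-excluded-middle; decidable-stable)
open import Algebra.Morphism.Structures using (IsRingHomomorphism)
import Algebra.Properties.Ring as RingProperties
import Algebra.Solver.Ring.NaturalCoefficients as NaturalCoefficients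
import Relation.Binary.Reasoning.Setoid as SetoidReasoning

¬¬-bind : ∀ {a b} {A : Set a} {B : Set b} → ¬ ¬ A → (A → ¬ ¬ B) → ¬ ¬ B
¬¬-bind ¬¬a f ¬b = ¬¬a (λ a → f a ¬b)

¬¬-pull-Fin : ∀ {p} m {P : Fin m → Set p} → (∀ i → ¬ ¬ P i) → ¬ ¬ (∀ i → P i)
¬¬-pull-Fin zeroℕ    ¬¬P ¬∀P = ¬∀P (λ ())
¬¬-pull-Fin (sucℕ m) ¬¬P ¬∀P = ¬¬P zero λ P₀ →
  ¬¬-pull-Fin m (λ i → ¬¬P (suc i)) λ P₊ → ¬∀P λ { zero → P₀ ; (suc i) → P₊ i }

module _ {a p} {A : Set a} {P : A → Set p} {xs : List A} where

  All-lookup : All P xs → ∀ i → P (lookup xs i)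
  All-lookup pxs i = All.lookup pxs (∈-lookup i)

  All-tabulate-lookup : (∀ i → P (lookup xs i)) → All P xs
  All-tabulate-lookup Pxs =
    All.tabulate λ x∈xs → ≡.subst P (≡.sym (lookup-index x∈xs)) (Pxs (index x∈xs))

module LinearSystems {c ℓ} (L : Field c ℓ) where
  open Field L hiding (zero)
  open RingProperties ring using (-‿distribˡ-*; +-cancelʳ)
  open NaturalCoefficients commutativeSemiring (λ _ _ → nothing)
    using (solve; _:=_; _:+_; _:*_)
  open SetoidReasoning setoid

  Σ-cong : ∀ d {f g : Fin d → Carrier} → (∀ i → f i ≈ g i) → Σ[<_] L d f ≈ Σ[<_] L d g
  Σ-cong zeroℕ    f≈g = refl
  Σ-cong (sucℕ d) f≈g = +-cong (f≈g zero) (Σ-cong d (λ i → f≈g (suc i)))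

  if-then-0-cong : ∀ (b : Bool) {u v} → u ≈ v →
                   (if b then u else 0#) ≈ (if b then v else 0#)
  if-then-0-cong true  u≈v = u≈v
  if-then-0-cong false u≈v = refl

  linear-cong : ∀ {d} {a a' x y : Fin d → Carrier} →
                (∀ i → a i ≈ a' i) → (∀ i → x i ≈ y i) → linear L a x ≈ linear L a' y
  linear-cong {d} a≈a' x≈y = Σ-cong d (λ i → *-cong (a≈a' i) (x≈y i))

  linear-zeroʳ : ∀ {d} (a : Fin d → Carrier) → linear L a (λ _ → 0#) ≈ 0#
  linear-zeroʳ {zeroℕ}  a = refl
  linear-zeroʳ {sucℕ d} a =
    trans (+-cong (zeroʳ (a zero)) (linear-zeroʳ (tail a))) (+-identityˡ 0#)

  linear-scaleˡ : ∀ {d} (t : Carrier) (a x : Fin d → Carrier) →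
                  linear L (λ i → t * a i) x ≈ t * linear L a x
  linear-scaleˡ {zeroℕ}  t a x = sym (zeroʳ t)
  linear-scaleˡ {sucℕ d} t a x = begin
    t * a zero * x zero + linear L (λ i → t * tail a i) (tail x)
      ≈⟨ +-cong (*-assoc t (a zero) (x zero)) (linear-scaleˡ t (tail a) (tail x)) ⟩
    t * (a zero * x zero) + t * linear L (tail a) (tail x)
      ≈⟨ distribˡ t _ _ ⟨
    t * linear L a x ∎

  linear-addʳ : ∀ {d} (a u v : Fin d → Carrier) (μ : Carrier) →
                linear L a (λ i → u i + μ * v i) ≈ linear L a u + μ * linear L a v
  linear-addʳ {zeroℕ}  a u v μ = sym (trans (+-identityˡ _) (zeroʳ μ))
  linear-addʳ {sucℕ d} a u v μ = begin
    a zero * (u zero + μ * v zero) + linear L (tail a) (λ i → tail u i + μ * tail v i)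
      ≈⟨ +-congˡ (linear-addʳ (tail a) (tail u) (tail v) μ) ⟩
    a zero * (u zero + μ * v zero) + (U + μ * V)
      ≈⟨ solve 6 (λ a₀ u₀ v₀ μ U V → a₀ :* (u₀ :+ μ :* v₀) :+ (U :+ μ :* V)
                                     := (a₀ :* u₀ :+ U) :+ μ :* (a₀ :* v₀ :+ V))
               refl (a zero) (u zero) (v zero) μ U V ⟩
    linear L a u + μ * linear L a v ∎
    where
    U = linear L (tail a) (tail u)
    V = linear L (tail a) (tail v)

  unit : ∀ {d} → Fin d → Fin d → Carrier
  unit zero    = 1# ∷ᶠ λ _ → 0#
  unit (suc i) = 0# ∷ᶠ unit i

  linear-unit : ∀ {d} (a : Fin d → Carrier) (i : Fin d) → linear L a (unit i) ≈ a i
  linear-unit a zero    =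
    trans (+-cong (*-identityʳ (a zero)) (linear-zeroʳ (tail a))) (+-identityʳ _)
  linear-unit a (suc i) =
    trans (+-cong (zeroʳ (a zero)) (linear-unit (tail a) i)) (+-identityˡ _)

  linear-∷-1# : ∀ {d} (a : Fin d → Carrier) (b : Carrier) (x : Fin d → Carrier) →
                linear L (b ∷ᶠ a) (1# ∷ᶠ x) ≈ linear L a x + b
  linear-∷-1# a b x = trans (+-comm _ _) (+-congˡ (*-identityʳ b))

  linear-∷-0# : ∀ {d} (a : Fin d → Carrier) (b : Carrier) (x : Fin d → Carrier) →
                linear L (b ∷ᶠ a) (0# ∷ᶠ x) ≈ linear L a x
  linear-∷-0# a b x = trans (+-congʳ (zeroʳ b)) (+-identityˡ _)

  evalQ-cong : ∀ {d} (q : QuadForm L d) {x y : Point L d} →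
               _≋_ L x y → evalQ L q x ≈ evalQ L q y
  evalQ-cong {d} q x≋y =
    Σ-cong d λ i → Σ-cong d λ j → if-then-0-cong _ (*-congˡ (*-cong (x≋y i) (x≋y j)))

  OnHyperplane-resp : ∀ {d} (a : Fin d → Carrier) b {x y : Point L d} →
                      _≋_ L x y → OnHyperplane L a b x → OnHyperplane L a b y
  OnHyperplane-resp a b x≋y =
    trans (+-congʳ (linear-cong (λ _ → refl) (λ i → sym (x≋y i))))

  OnQuadric-resp : ∀ {d} (q : QuadForm L d) (a : Fin d → Carrier) b {x y : Point L d} →
                   _≋_ L x y → OnQuadric L q a b x → OnQuadric L q a b y
  OnQuadric-resp q a b x≋y = trans (+-cong (evalQ-cong q y≋x) (+-congʳ (linear-cong (λ _ → refl) y≋x)))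
    where y≋x = λ i → sym (x≋y i)

  IsSolution : ∀ {m k} → (Fin m → Fin k → Carrier) → (Fin m → Carrier) → (Fin k → Carrier) →
               Set ℓ
  IsSolution A b z = ∀ e → linear L z (A e) ≈ b e

  Solvable : ∀ {m k} → (Fin m → Fin k → Carrier) → (Fin m → Carrier) → Set (c ⊔ ℓ)
  Solvable A b = ∃ (IsSolution A b)

  IsSolution-cong : ∀ {m k} {A A' : Fin m → Fin k → Carrier} {b b' : Fin m → Carrier} →
                    (∀ e j → A e j ≈ A' e j) → (∀ e → b e ≈ b' e) →
                    ∀ {z} → IsSolution A b z → IsSolution A' b' z
  IsSolution-cong A≈A' b≈b' sol e =
    trans (linear-cong (λ _ → refl) (λ j → sym (A≈A' e j))) (trans (sol e) (b≈b' e))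

  IsSolution-scale : ∀ {m k} {A : Fin m → Fin k → Carrier} {b : Fin m → Carrier} (t : Carrier) →
                     ∀ {z} → IsSolution A b z → IsSolution A (λ e → t * b e) (λ j → t * z j)
  IsSolution-scale {A = A} t {z} sol e = trans (linear-scaleˡ t z (A e)) (*-congˡ (sol e))

  module _ {m k} {A : Fin m → Fin (sucℕ k) → Carrier} {b : Fin m → Carrier}
           (A₀≈0 : ∀ e → A e zero ≈ 0#) where

    IsSolution-tail : ∀ {z} → IsSolution A b z → IsSolution (λ e → tail (A e)) b (tail z)
    IsSolution-tail {z} sol e =
      trans (sym (trans (+-congʳ (trans (*-congˡ (A₀≈0 e)) (zeroʳ (z zero)))) (+-identityˡ _)))
            (sol e)

    IsSolution-∷ : ∀ x {w} → IsSolution (λ e → tail (A e)) b w → IsSolution A b (x ∷ᶠ w)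
    IsSolution-∷ x sol e =
      trans (+-congʳ (trans (*-congˡ (A₀≈0 e)) (zeroʳ x))) (trans (+-identityˡ _) (sol e))

  addRow : ∀ {m k} → (Fin m → Fin k → Carrier) → Fin m → (Fin m → Carrier) →
           Fin m → Fin k → Carrier
  addRow A p μ e j = A e j + μ e * A p j

  addRhs : ∀ {m} → (Fin m → Carrier) → Fin m → (Fin m → Carrier) → Fin m → Carrier
  addRhs b p μ e = b e + μ e * b p

  module _ {m k} (A : Fin m → Fin k → Carrier) (b : Fin m → Carrier)
           (p : Fin m) (μ : Fin m → Carrier) where

    IsSolution-addRow : ∀ {z} → IsSolution A b z → IsSolution (addRow A p μ) (addRhs b p μ) z
    IsSolution-addRow {z} sol e =
      trans (linear-addʳ z (A e) (A p) (μ e)) (+-cong (sol e) (*-congˡ (sol p)))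

    IsSolution-undoAddRow : ∀ {z} → linear L z (A p) ≈ b p →
                            IsSolution (addRow A p μ) (addRhs b p μ) z → IsSolution A b z
    IsSolution-undoAddRow {z} solₚ sol e = +-cancelʳ (μ e * b p) _ _ (begin
      linear L z (A e) + μ e * b p               ≈⟨ +-congˡ (*-congˡ solₚ) ⟨
      linear L z (A e) + μ e * linear L z (A p)  ≈⟨ linear-addʳ z (A e) (A p) (μ e) ⟨
      linear L z (addRow A p μ e)                ≈⟨ sol e ⟩
      b e + μ e * b p                            ∎)

  x-xsy≈0 : ∀ x {s y} → s * y ≈ 1# → x + - (x * s) * y ≈ 0#
  x-xsy≈0 x {s} {y} sy≈1 = begin
    x + - (x * s) * y  ≈⟨ +-congˡ (-‿distribˡ-* (x * s) y) ⟨
    x + - (x * s * y)  ≈⟨ +-congˡ (-‿cong (trans (*-assoc x s y) (*-congˡ sy≈1))) ⟩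
    x + - (x * 1#)     ≈⟨ +-congˡ (-‿cong (*-identityʳ x)) ⟩
    x + - x            ≈⟨ -‿inverseʳ x ⟩
    0#                 ∎

  s[x-t]y+t≈x : ∀ x t {s y} → y * s ≈ 1# → s * (x + - t) * y + t ≈ x
  s[x-t]y+t≈x x t {s} {y} ys≈1 = begin
    s * (x + - t) * y + t  ≈⟨ +-congʳ (trans (*-comm _ y) (sym (*-assoc y s _))) ⟩
    y * s * (x + - t) + t  ≈⟨ +-congʳ (trans (*-congʳ ys≈1) (*-identityˡ _)) ⟩
    x + - t + t            ≈⟨ +-assoc x (- t) t ⟩
    x + (- t + t)          ≈⟨ +-congˡ (-‿inverseˡ t) ⟩
    x + 0#                 ≈⟨ +-identityʳ x ⟩
    x                      ∎

  module Pivot {m k} (A : Fin m → Fin (sucℕ k) → Carrier) (b : Fin m → Carrier)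
               (p : Fin m) {s : Carrier} (A₀s≈1 : A p zero * s ≈ 1#) where

    eliminator : Fin m → Carrier
    eliminator e = - (A e zero * s)

    reduced : Fin m → Fin k → Carrier
    reduced e = tail (addRow A p eliminator e)

    reducedRhs : Fin m → Carrier
    reducedRhs = addRhs b p eliminator

    addRow-clears : ∀ e → addRow A p eliminator e zero ≈ 0#
    addRow-clears e = x-xsy≈0 (A e zero) (trans (*-comm s _) A₀s≈1)

    backSubstitute : Solvable reduced reducedRhs → Solvable A b
    backSubstitute (w , sol) =
      z , IsSolution-undoAddRow A b p eliminator {z} solₚ
            (IsSolution-∷ {A = addRow A p eliminator} {reducedRhs} addRow-clears _ sol)
      where
      z : Fin (sucℕ k) → Carrier
      z = s * (b p + - linear L w (tail (A p))) ∷ᶠ w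
      solₚ : linear L z (A p) ≈ b p
      solₚ = s[x-t]y+t≈x (b p) (linear L w (tail (A p))) A₀s≈1

module Embedding {c ℓ c' ℓ'} {F : Field c ℓ} {K : Field c' ℓ'} (E : FieldExtension F K)
  where
  open FieldExtension E
  open IsRingHomomorphism isRingHomo using (⟦⟧-cong; +-homo; *-homo; 0#-homo; 1#-homo)
  private
    module F = Field F
    module K = Field K
    module LF = LinearSystems F
    module LK = LinearSystems K

  embed-Σ : ∀ d (f : Fin d → F.Carrier) → embed (Σ[<_] F d f) K.≈ Σ[<_] K d (embed ∘ f)
  embed-Σ zeroℕ    f = 0#-homo
  embed-Σ (sucℕ d) f = K.trans (+-homo _ _) (K.+-congˡ (embed-Σ d (f ∘ suc)))

  embed-+* : ∀ x y z → embed (x F.+ y F.* z) K.≈ embed x K.+ embed y K.* embed z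
  embed-+* x y z = K.trans (+-homo x _) (K.+-congˡ (*-homo y z))

  embed-if : ∀ (b : Bool) u → embed (if b then u else F.0#) K.≈ (if b then embed u else K.0#)
  embed-if true  u = K.refl
  embed-if false u = 0#-homo

  embed-evalQ : ∀ {d} (q : QuadForm F d) (x : Point F d) →
                embed (evalQ F q x) K.≈ evalQ K (mapQ E q) (embed ∘ x)
  embed-evalQ {d} q x =
    K.trans (embed-Σ d _) (LK.Σ-cong d λ i →
    K.trans (embed-Σ d _) (LK.Σ-cong d λ j →
    K.trans (embed-if _ _) (LK.if-then-0-cong _ (K.trans (*-homo _ _) (K.*-congˡ (*-homo _ _))))))

  embed-unit : ∀ {d} (i j : Fin d) → embed (LF.unit i j) K.≈ LK.unit i j
  embed-unit zero    zero    = 1#-homo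
  embed-unit zero    (suc j) = 0#-homo
  embed-unit (suc i) zero    = 0#-homo
  embed-unit (suc i) (suc j) = embed-unit i j

  embed-∷ : ∀ {k} {x : F.Carrier} {x̂ : K.Carrier} {v : Fin k → F.Carrier} {v̂ : Fin k → K.Carrier} →
            embed x K.≈ x̂ → (∀ j → embed (v j) K.≈ v̂ j) →
            ∀ j → embed ((x ∷ᶠ v) j) K.≈ (x̂ ∷ᶠ v̂) j
  embed-∷ x≈x̂ v≈v̂ zero    = x≈x̂
  embed-∷ x≈x̂ v≈v̂ (suc j) = v≈v̂ j

  0≈embed⇒¬¬0≈ : ∀ {x} → K.0# K.≈ embed x → ¬ ¬ (F.0# F.≈ x)
  0≈embed⇒¬¬0≈ {x} 0≈x̂ 0≉x with F.inverse x (0≉x ∘ F.sym)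
  ... | y , xy≈1 = K.0≉1 (begin
    K.0#                 ≈⟨ K.zeroˡ (embed y) ⟨
    K.0# K.* embed y     ≈⟨ K.*-congʳ 0≈x̂ ⟩
    embed x K.* embed y  ≈⟨ *-homo x y ⟨
    embed (x F.* y)      ≈⟨ ⟦⟧-cong xy≈1 ⟩
    embed F.1#           ≈⟨ 1#-homo ⟩
    K.1#                 ∎)
    where open SetoidReasoning K.setoid

  descent : ∀ k {m} (A : Fin m → Fin k → F.Carrier) (b : Fin m → F.Carrier) →
            LK.Solvable (λ e j → embed (A e j)) (embed ∘ b) → ¬ ¬ LF.Solvable A b
  descent zeroℕ {m} A b (_ , sol) =
    ¬¬-map (λ sol₀ → (λ ()) , sol₀) (¬¬-pull-Fin m (λ e → 0≈embed⇒¬¬0≈ (sol e)))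
  descent (sucℕ k) {m} A b (z , sol) = ¬¬-bind pivot? λ where
      (yes (p , A₀≉0)) → pivotStep p A₀≉0
      (no noPivot)     →
        ¬¬-bind (¬¬-pull-Fin m λ e A₀≉0 → noPivot (e , A₀≉0)) zeroColumnStep
    where
    pivot? : ¬ ¬ Dec (∃ λ p → ¬ (A p zero F.≈ F.0#))
    pivot? = ¬¬-excluded-middle

    zeroColumnStep : (∀ e → A e zero F.≈ F.0#) → ¬ ¬ LF.Solvable A b
    zeroColumnStep A₀≈0 =
      ¬¬-map (λ (w , solw) → F.0# ∷ᶠ w , LF.IsSolution-∷ {A = A} A₀≈0 F.0# {w} solw)
        (descent k (λ e → tail (A e)) b (tail z , solTail))
      where
      solTail : LK.IsSolution (λ e j → embed (A e (suc j))) (embed ∘ b) (tail z)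
      solTail = LK.IsSolution-tail {A = λ e j → embed (A e j)}
                  (λ e → K.trans (⟦⟧-cong (A₀≈0 e)) 0#-homo) {z} sol

    pivotStep : ∀ p → ¬ (A p zero F.≈ F.0#) → ¬ ¬ LF.Solvable A b
    pivotStep p A₀≉0 with F.inverse (A p zero) A₀≉0
    ... | s , A₀s≈1 =
      ¬¬-map backSubstitute (descent k reduced reducedRhs (tail z , reducedSol))
      where
      open LF.Pivot A b p A₀s≈1
      embeddedSol : LK.IsSolution (λ e j → embed (LF.addRow A p eliminator e j))
                                  (embed ∘ reducedRhs) z
      embeddedSol =
        LK.IsSolution-cong (λ e j → K.sym (embed-+* (A e j) (eliminator e) (A p j)))
                           (λ e → K.sym (embed-+* (b e) (eliminator e) (b p))) {z}
          (LK.IsSolution-addRow (λ e j → embed (A e j)) (embed ∘ b) p (embed ∘ eliminator) {z} sol)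
      reducedSol : LK.IsSolution (λ e j → embed (reduced e j)) (embed ∘ reducedRhs) (tail z)
      reducedSol = LK.IsSolution-tail {A = λ e j → embed (LF.addRow A p eliminator e j)}
                     (λ e → K.trans (⟦⟧-cong (addRow-clears e)) 0#-homo) {z} embeddedSol

module Transfer {c ℓ c' ℓ' p} {F : Field c ℓ} {K : Field c' ℓ'} (E : FieldExtension F K)
                {d : ℕ} (D : Point F d → Set p) where
  open FieldExtension E
  open IsRingHomomorphism isRingHomo using (⟦⟧-cong; 0#-homo; 1#-homo; -‿homo)
  open Embedding E using (embed-evalQ; embed-unit; embed-∷; descent)
  private
    module F = Field F
    module K = Field K
    module LF = LinearSystems F
    module LK = LinearSystems K

  embedPoint : Point F d → Point K d
  embedPoint x = embed ∘ x

  module _ {s} (S : Point K d → Set s) (S-resp : ∀ {y y'} → _≋_ K y y' → S y → S y') where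

    preimages : ∀ {ys} → All (λ y → image E D y × S y) ys → List (Point F d)
    preimages []                    = []
    preimages (((x , _) , _) ∷ ms) = x ∷ preimages ms

    length-preimages : ∀ {ys} (ms : All (λ y → image E D y × S y) ys) →
                       length (preimages ms) ≡ length ys
    length-preimages []       = ≡.refl
    length-preimages (_ ∷ ms) = ≡.cong sucℕ (length-preimages ms)

    preimages-members : ∀ {ys} (ms : All (λ y → image E D y × S y) ys) →
                        All (λ x → D x × S (embedPoint x)) (preimages ms)
    preimages-members []                            = []
    preimages-members (((x , Dx , y≋x̂) , Sy) ∷ ms) =
      (Dx , S-resp y≋x̂ Sy) ∷ preimages-members ms

    preimages-apart : ∀ {y x ys} → _≋_ K y (embedPoint x) →
                      (ms : All (λ y → image E D y × S y) ys) →
                      All (λ y' → ¬ _≋_ K y y') ys → All (λ x' → ¬ _≋_ F x x') (preimages ms)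
    preimages-apart y≋x̂ []                              []            = []
    preimages-apart y≋x̂ (((x' , _ , y'≋x̂') , _) ∷ ms) (y≉y' ∷ y≉ys) =
      (λ x≋x' → y≉y' λ i → K.trans (y≋x̂ i) (K.trans (⟦⟧-cong (x≋x' i)) (K.sym (y'≋x̂' i))))
      ∷ preimages-apart y≋x̂ ms y≉ys

    preimages-distinct : ∀ {ys} (ms : All (λ y → image E D y × S y) ys) →
                         AllPairs (λ y y' → ¬ _≋_ K y y') ys →
                         AllPairs (λ x x' → ¬ _≋_ F x x') (preimages ms)
    preimages-distinct []                          []              = []
    preimages-distinct (((_ , _ , y≋x̂) , _) ∷ ms) (y≉ys ∷ distinct) =
      preimages-apart y≋x̂ ms y≉ys ∷ preimages-distinct ms distinct

    AtMost-image : ∀ {n} → AtMost F n D (S ∘ embedPoint) → AtMost K n (image E D) S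
    AtMost-image {n} atMost ys distinct ms =
      ≡.subst (_≤ n) (length-preimages ms)
        (atMost _ (preimages-distinct ms distinct) (preimages-members ms))

  hyperplane-descends :
    ((a : Fin d → F.Carrier) (b : F.Carrier) → (Σ (Fin d) λ i → ¬ (a i F.≈ F.0#)) →
      AtMost F d D (OnHyperplane F a b)) →
    (a : Fin d → K.Carrier) (b : K.Carrier) → (Σ (Fin d) λ i → ¬ (a i K.≈ K.0#)) →
    AtMost F d D (OnHyperplane K a b ∘ embedPoint)
  hyperplane-descends generic a b (i , aᵢ≉0) xs distinct members =
    decidable-stable (length xs ≤? d)
      (¬¬-map fromSolution (descent (sucℕ d) rows rhs (scaledSolution , solutionK)))
    where
    -- Row 0 normalises coefficient i to 1; row e + 1 puts xₑ on the hyperplane.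
    rows : Fin (sucℕ (length xs)) → Fin (sucℕ d) → F.Carrier
    rows = (F.0# ∷ᶠ LF.unit i) ∷ᶠ λ e → F.1# ∷ᶠ lookup xs e

    rhs : Fin (sucℕ (length xs)) → F.Carrier
    rhs = F.1# ∷ᶠ λ _ → F.0#

    rowsK : Fin (sucℕ (length xs)) → Fin (sucℕ d) → K.Carrier
    rowsK = (K.0# ∷ᶠ LK.unit i) ∷ᶠ λ e → K.1# ∷ᶠ embedPoint (lookup xs e)

    embed-rows : ∀ e j → embed (rows e j) K.≈ rowsK e j
    embed-rows zero    = embed-∷ 0#-homo (embed-unit i)
    embed-rows (suc e) = embed-∷ 1#-homo (λ _ → K.refl)

    t : K.Carrier
    t = proj₁ (K.inverse (a i) aᵢ≉0)

    unscaled : LK.IsSolution rowsK (a i ∷ᶠ λ _ → K.0#) (b ∷ᶠ a)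
    unscaled zero    = K.trans (LK.linear-∷-0# a b (LK.unit i)) (LK.linear-unit a i)
    unscaled (suc e) = K.trans (LK.linear-∷-1# a b _) (proj₂ (All-lookup members e))

    scaled-rhs : ∀ e → t K.* (a i ∷ᶠ λ _ → K.0#) e K.≈ embed (rhs e)
    scaled-rhs zero    =
      K.trans (K.*-comm t (a i)) (K.trans (proj₂ (K.inverse (a i) aᵢ≉0)) (K.sym 1#-homo))
    scaled-rhs (suc e) = K.trans (K.zeroʳ t) (K.sym 0#-homo)

    scaledSolution : Fin (sucℕ d) → K.Carrier
    scaledSolution j = t K.* (b ∷ᶠ a) j

    solutionK : LK.IsSolution (λ e j → embed (rows e j)) (embed ∘ rhs) scaledSolution
    solutionK = LK.IsSolution-cong (λ e j → K.sym (embed-rows e j)) scaled-rhs {scaledSolution}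
                  (LK.IsSolution-scale {A = rowsK} t {b ∷ᶠ a} unscaled)

    fromSolution : LF.Solvable rows rhs → length xs ≤ d
    fromSolution (w , sol) =
      generic (tail w) (w zero) (i , wᵢ≉0) xs distinct
        (All.zip (All.map proj₁ members , All-tabulate-lookup onHyperplane))
      where
      wᵢ≈1 : tail w i F.≈ F.1#
      wᵢ≈1 = F.trans (F.sym (LF.linear-unit (tail w) i))
                     (F.trans (F.sym (LF.linear-∷-0# (tail w) (w zero) (LF.unit i))) (sol zero))
      wᵢ≉0 : ¬ (tail w i F.≈ F.0#)
      wᵢ≉0 wᵢ≈0 = F.0≉1 (F.trans (F.sym wᵢ≈0) wᵢ≈1)
      onHyperplane : ∀ e → OnHyperplane F (tail w) (w zero) (lookup xs e)
      onHyperplane e =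
        F.trans (F.sym (LF.linear-∷-1# (tail w) (w zero) (lookup xs e))) (sol (suc e))

  quadric-descends : (q : QuadForm F d) →
    ((a : Fin d → F.Carrier) (b : F.Carrier) → AtMost F (sucℕ d) D (OnQuadric F q a b)) →
    (a : Fin d → K.Carrier) (b : K.Carrier) →
    AtMost F (sucℕ d) D (OnQuadric K (mapQ E q) a b ∘ embedPoint)
  quadric-descends q generic a b xs distinct members =
    decidable-stable (length xs ≤? sucℕ d)
      (¬¬-map fromSolution (descent (sucℕ d) rows rhs (b ∷ᶠ a , solutionK)))
    where
    rows : Fin (length xs) → Fin (sucℕ d) → F.Carrier
    rows e = F.1# ∷ᶠ lookup xs e

    rhs : Fin (length xs) → F.Carrier
    rhs e = F.- evalQ F q (lookup xs e)

    solutionK : LK.IsSolution (λ e j → embed (rows e j)) (embed ∘ rhs) (b ∷ᶠ a)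
    solutionK e = begin
      linear K (b ∷ᶠ a) (embed ∘ rows e)
        ≈⟨ LK.linear-cong {a = b ∷ᶠ a} (λ _ → K.refl) (embed-∷ {v = xₑ} 1#-homo (λ _ → K.refl)) ⟩
      linear K (b ∷ᶠ a) (K.1# ∷ᶠ embedPoint xₑ)
        ≈⟨ LK.linear-∷-1# a b (embedPoint xₑ) ⟩
      linear K a (embedPoint xₑ) K.+ b
        ≈⟨ +-inverseʳ-unique _ _ (proj₂ (All-lookup members e)) ⟩
      K.- evalQ K (mapQ E q) (embedPoint xₑ)
        ≈⟨ K.-‿cong (embed-evalQ q xₑ) ⟨
      K.- embed (evalQ F q xₑ)
        ≈⟨ -‿homo _ ⟨
      embed (rhs e) ∎
      where
      open SetoidReasoning K.setoid
      open RingProperties K.ring using (+-inverseʳ-unique)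
      xₑ = lookup xs e

    fromSolution : LF.Solvable rows rhs → length xs ≤ sucℕ d
    fromSolution (w , sol) =
      generic (tail w) (w zero) xs distinct
        (All.zip (All.map proj₁ members , All-tabulate-lookup onQuadric))
      where
      onQuadric : ∀ e → OnQuadric F q (tail w) (w zero) (lookup xs e)
      onQuadric e = F.trans
        (F.+-congˡ (F.trans (F.sym (LF.linear-∷-1# (tail w) (w zero) (lookup xs e))) (sol e)))
        (F.-‿inverseʳ _)

lemma3p7 : ∀ {c ℓ c' ℓ' p} (F : Field c ℓ) (d : ℕ) (Q : QuadForm F d)
    → NonzeroQ F Q → (D : Point F d → Set p) → IsGeneric F Q D
    → (K : Field c' ℓ') (E : FieldExtension F K)
    → IsGeneric K (mapQ E Q) (image E D)
lemma3p7 F d Q _ D (hyperplanes , quadrics) K E =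
    (λ a b a≉0 → AtMost-image (OnHyperplane K a b) (OnHyperplane-resp a b)
                   (hyperplane-descends hyperplanes a b a≉0))
  , (λ a b → AtMost-image (OnQuadric K (mapQ E Q) a b) (OnQuadric-resp (mapQ E Q) a b)
               (quadric-descends Q quadrics a b))
  where
  open Transfer E D
  open LinearSystems K using (OnHyperplane-resp; OnQuadric-resp)
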